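{- Let $\Delta$ be a strongly shellable simplicial complex and let $S$ be a subset of its vertex set such that for every facet $\sigma$ of $\Delta$, the set $\sigma\cap S$ is a facet of the induced complex $\Delta[S]=\{F\in\Delta: F\subseteq S\}$. Then $\Delta[S]$ is strongly shellable, and every strong shelling order $\succ$ on $\mathcal{F}(\Delta)$ induces a strong shelling order $\succ_S$ on $\mathcal{F}(\Delta[S])$; namely, for $F\in\mathcal{F}(\Delta[S])$ let $\widetilde F$ be the first facet of $\Delta$ with respect to $\succ$ with $\widetilde F\cap S=F$, and set $F\succ_S G$ iff $\widetilde F\succ\widetilde G$.
   Context: A simplicial complex is a finite family of subsets of a vertex set closed under taking subsets; $\mathcal{F}(\Delta)$ is its set of facets. A linear order $F_1,\dots,F_t$ of $\mathcal{F}(\Delta)$ (with $F_i\succ F_j$ iff $i<j$) is a strong shelling order if for every $1\le i<j\le t$ there exists $k$ with $1\le k<j$ such that $|F_j\setminus F_k|=1$, $F_j\setminus F_k\subseteq F_j\setminus F_i$, and $F_k\setminus F_j\subseteq F_i$; $\Delta$ is strongly shellable if such an order exists. -}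

module Defs where

open import Data.Nat using (ℕ)
open import Data.Fin using (Fin; _<_)
open import Data.Fin.Subset using (Subset; _⊆_; _∩_; _─_; ∣_∣)
open import Data.List using (List; length; lookup)
open import Data.List.Membership.Propositional using (_∈_)
open import Data.List.Relation.Unary.Unique.Propositional using (Unique)
open import Data.Product using (Σ; ∃; _×_; _,_; proj₁; proj₂)
open import Relation.Binary.PropositionalEquality using (_≡_; _≢_)

record Complex (n : ℕ) : Set₁ where
  field
    Face   : Subset n → Set
    closed : ∀ {F G} → Face F → G ⊆ F → Face G
open Complex public

IsFacet : ∀ {n} → Complex n → Subset n → Set
IsFacet Δ F = Face Δ F × (∀ G → Face Δ G → F ⊆ G → G ≡ F)

induced : ∀ {n} → Complex n → Subset n → Complex n
induced Δ S = record
  { Face   = λ F → Face Δ F × F ⊆ S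
  ; closed = λ {F} {G} p G⊆F →
      closed Δ (proj₁ p) G⊆F , λ x∈G → proj₂ p (G⊆F x∈G) }

-- A linear order on F(Δ): a duplicate-free list enumerating exactly the
-- facets; position i precedes position j (F_i ≻ F_j) iff i < j.
IsFacetOrder : ∀ {n} → Complex n → List (Subset n) → Set
IsFacetOrder Δ L =
  Unique L × (∀ F → F ∈ L → IsFacet Δ F) × (∀ F → IsFacet Δ F → F ∈ L)

IsStrongShellingOrder : ∀ {n} → Complex n → List (Subset n) → Set
IsStrongShellingOrder Δ L =
  IsFacetOrder Δ L ×
  (∀ (i j : Fin (length L)) → i < j →
     Σ (Fin (length L)) λ k → k < j ×
       (∣ lookup L j ─ lookup L k ∣ ≡ 1) ×
       ((lookup L j ─ lookup L k) ⊆ (lookup L j ─ lookup L i)) ×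
       ((lookup L k ─ lookup L j) ⊆ lookup L i))

StronglyShellable : ∀ {n} → Complex n → Set
StronglyShellable Δ = ∃ λ L → IsStrongShellingOrder Δ L

IsFirstRestriction : ∀ {n} (L : List (Subset n)) → Subset n → Subset n →
                     Fin (length L) → Set
IsFirstRestriction L S F p =
  (lookup L p ∩ S ≡ F) × (∀ q → q < p → lookup L q ∩ S ≢ F)

IsInducedOrder : ∀ {n} → Complex n → Subset n → List (Subset n) →
                 List (Subset n) → Set
IsInducedOrder Δ S L M =
  IsFacetOrder (induced Δ S) M ×
  (∀ (i j : Fin (length M)) (p q : Fin (length L)) →
     IsFirstRestriction L S (lookup M i) p →
     IsFirstRestriction L S (lookup M j) q →
     (i < j → p < q) × (p < q → i < j))

-- Fix a strong shelling of Δ and let F̃ be its first facet restricting to F;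
-- every facet of Δ[S] is such an F, since it extends to a facet of Δ.  For
-- F̃ ≻ G̃ the shelling of Δ provides an earlier σ exchanging one vertex with G̃.
-- G ⊆ σ ∩ S is impossible: maximality of the facet G of Δ[S] would force
-- σ ∩ S = G, contradicting the minimality of G̃.  So the exchanged vertex lies
-- in S, σ ∩ S is an exchange partner for G, and the first facet restricting
-- to σ ∩ S comes no later than σ, hence before G̃.
module Submission where

open import Defs
open import Data.Nat using (ℕ; zero; suc; z≤n; s≤s; _∸_) renaming (_<_ to _<ℕ_; _≤_ to _≤ℕ_)
import Data.Nat.Properties as ℕ
open import Data.Fin using (Fin; zero; suc; toℕ; _<_; _≤_; cast; fromℕ<)
open import Data.Fin.Properties
  using (toℕ-injective; toℕ-inject; toℕ-fromℕ<; toℕ-cast; cast-involutive; _<?_; all?; <-cmp;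
         ¬∀⟶∃¬; ¬∀⟶∃¬-smallest)
open import Data.Fin.Subset
  using (Subset; inside; outside; _∩_; _─_; ∣_∣; _⊆_; Nonempty) renaming (_∈_ to _∈ₛ_; _∉_ to _∉ₛ_)
open import Data.Fin.Subset.Properties
  using (_∈?_; x∈p∩q⁺; x∈p∩q⁻; x∈p∧x∉q⇒x∈p─q; x∈p⇒∣p-x∣<∣p∣; p⊆q⇒∣p∣≤∣q∣; p⊂q⇒∣p∣<∣q∣; ∣p∣≤n;
         ⊆-antisym)
open import Data.List using (List; []; _∷_; length; lookup; map; filter; allFin)
open import Data.List.Properties using (length-map)
open import Data.List.Membership.Propositional using (_∈_)
open import Data.List.Membership.Propositional.Properties
  using (∈-lookup; ∈-map⁺; ∈-map⁻; ∈-filter⁺; ∈-allFin)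
open import Data.List.Relation.Unary.All as All using (All)
open import Data.List.Relation.Unary.All.Properties using (all-filter)
open import Data.List.Relation.Unary.AllPairs using (AllPairs; []; _∷_)
open import Data.List.Relation.Unary.AllPairs.Properties using (tabulate⁺-<; filter⁺)
open import Data.List.Relation.Unary.Any using (index; any?)
open import Data.List.Relation.Unary.Any.Properties using (lookup-index)
open import Data.List.Relation.Unary.Unique.Propositional using (Unique)
open import Data.Vec using (_∷_; here; there)
import Data.Vec.Properties as Vec
import Data.Bool.Properties as Bool
open import Data.Product using (Σ; ∃; _×_; _,_; proj₁; proj₂)
open import Function using (_∘_)
open import Relation.Nullary using (¬_; Dec; yes; no; contradiction)
open import Relation.Nullary.Decidable using (_×-dec_; _→-dec_; ¬?; decidable-stable)
open import Relation.Unary using (Pred; Decidable)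
open import Relation.Binary using (Rel; tri<; tri≈; tri>)
open import Relation.Binary.PropositionalEquality

infix 4 _≟ₛ_
_≟ₛ_ : ∀ {n} (p q : Subset n) → Dec (p ≡ q)
_≟ₛ_ = Vec.≡-dec Bool._≟_

module _ {a ℓ} {A : Set a} {R : Rel A ℓ} where

  AllPairs-lookup : ∀ {xs : List A} → AllPairs R xs →
                    ∀ {i j} → i < j → R (lookup xs i) (lookup xs j)
  AllPairs-lookup (Rx ∷ _)   {zero}  {suc j} _         = All.lookup Rx (∈-lookup j)
  AllPairs-lookup (_  ∷ Rxs) {suc i} {suc j} (s≤s i<j) = AllPairs-lookup Rxs i<j

  lookup⇒AllPairs : ∀ {xs : List A} → (∀ {i j} → i < j → R (lookup xs i) (lookup xs j)) →
                    AllPairs R xs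
  lookup⇒AllPairs {[]}     _ = []
  lookup⇒AllPairs {x ∷ xs} R-lookup =
    All.tabulate (λ y∈xs → subst (R x) (sym (lookup-index y∈xs))
                                      (R-lookup {zero} {suc (index y∈xs)} (s≤s z≤n)))
    ∷ lookup⇒AllPairs (R-lookup ∘ s≤s)

lookup-map : ∀ {A B : Set} (f : A → B) (xs : List A) (i : Fin (length (map f xs))) →
             lookup (map f xs) i ≡ f (lookup xs (cast (length-map f xs) i))
lookup-map f (x ∷ xs) zero    = refl
lookup-map f (x ∷ xs) (suc i) = lookup-map f xs i

cast-< : ∀ {m n} .(eq : m ≡ n) {i j : Fin m} → i < j → cast eq i < cast eq j
cast-< eq {i} {j} = subst₂ _<ℕ_ (sym (toℕ-cast eq i)) (sym (toℕ-cast eq j))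

<-reflect : ∀ {m n} {f : Fin m → Fin n} → (∀ {i j} → i < j → f i < f j) →
            ∀ {i j} → f i < f j → i < j
<-reflect {f = f} f-mono {i} {j} fi<fj with <-cmp i j
... | tri< i<j _ _ = i<j
... | tri≈ _ refl _ = contradiction fi<fj (ℕ.<-irrefl refl)
... | tri> _ _ j<i = contradiction (f-mono j<i) (ℕ.<-asym fi<fj)

least-witness : ∀ {m ℓ} {P : Pred (Fin m) ℓ} → Decidable P → ∀ {i} → P i →
                ∃ λ k → k ≤ i × P k × (∀ j → j < k → ¬ P j)
least-witness {m} {P = P} P? {i} Pi =
  k , ℕ.≮⇒≥ (λ i<k → below i i<k Pi) , decidable-stable (P? k) ¬¬Pk , below
  where
  smallest = ¬∀⟶∃¬-smallest m (¬_ ∘ P) (¬? ∘ P?) (λ ∀¬P → ∀¬P i Pi)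
  k = proj₁ smallest
  ¬¬Pk = proj₁ (proj₂ smallest)
  below : ∀ j → j < k → ¬ P j
  below j j<k = subst (¬_ ∘ P) (toℕ-injective (trans (toℕ-inject _) (toℕ-fromℕ< j<k)))
                                (proj₂ (proj₂ smallest) (fromℕ< j<k))

x∈p─q⁻ : ∀ {n} {x : Fin n} {p q : Subset n} → x ∈ₛ p ─ q → x ∈ₛ p × x ∉ₛ q
x∈p─q⁻ {p = inside  ∷ p} {outside ∷ q} here = here , λ ()
x∈p─q⁻ {x = zero} {p = outside ∷ p} {inside  ∷ q} ()
x∈p─q⁻ {x = zero} {p = outside ∷ p} {outside ∷ q} ()
x∈p─q⁻ {p = _ ∷ p} {_ ∷ q} (there x∈p─q) =
  there (proj₁ (x∈p─q⁻ x∈p─q)) , λ { (there x∈q) → proj₂ (x∈p─q⁻ x∈p─q) x∈q }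

p∩r─q∩r⊆p─q : ∀ {n} (p q r : Subset n) → (p ∩ r) ─ (q ∩ r) ⊆ p ─ q
p∩r─q∩r⊆p─q p q r x∈ =
  let x∈p∩r , x∉q∩r = x∈p─q⁻ x∈ ; x∈p , x∈r = x∈p∩q⁻ p r x∈p∩r
  in x∈p∧x∉q⇒x∈p─q x∈p (λ x∈q → x∉q∩r (x∈p∩q⁺ (x∈q , x∈r)))

⊈⇒Nonempty─ : ∀ {n} {p q : Subset n} → ¬ p ⊆ q → Nonempty (p ─ q)
⊈⇒Nonempty─ {n} {p} {q} p⊈q with ¬∀⟶∃¬ n (λ x → x ∈ₛ p → x ∈ₛ q) (λ x → x ∈? p →-dec x ∈? q)
                                     (λ ∀x → p⊈q (∀x _))
... | x , x∈p⇏x∈q with x ∈? p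
...   | yes x∈p = x , x∈p∧x∉q⇒x∈p─q x∈p (λ x∈q → x∈p⇏x∈q (λ _ → x∈q))
...   | no  x∉p = contradiction (λ x∈p → contradiction x∈p x∉p) x∈p⇏x∈q

Nonempty⇒0<∣p∣ : ∀ {n} {p : Subset n} → Nonempty p → 0 <ℕ ∣ p ∣
Nonempty⇒0<∣p∣ (x , x∈p) = ℕ.≤-trans (s≤s z≤n) (x∈p⇒∣p-x∣<∣p∣ x∈p)

StrongShellingStep : ∀ {n} → Subset n → Subset n → Subset n → Set
StrongShellingStep F G H = (∣ F ─ G ∣ ≡ 1) × ((F ─ G) ⊆ (F ─ H)) × ((G ─ F) ⊆ H)

StrongShellingStep-∩ : ∀ {n} {F G H : Subset n} (S : Subset n) → StrongShellingStep F G H →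
                       ¬ (F ∩ S) ⊆ (G ∩ S) → StrongShellingStep (F ∩ S) (G ∩ S) (H ∩ S)
StrongShellingStep-∩ {F = F} {G} {H} S (∣F─G∣≡1 , F─G⊆F─H , G─F⊆H) F∩S⊈G∩S =
  card , F∩S─G∩S⊆F∩S─H∩S , G∩S─F∩S⊆H∩S
  where
  card : ∣ (F ∩ S) ─ (G ∩ S) ∣ ≡ 1
  card = ℕ.≤-antisym
    (subst (∣ (F ∩ S) ─ (G ∩ S) ∣ ≤ℕ_) ∣F─G∣≡1 (p⊆q⇒∣p∣≤∣q∣ (p∩r─q∩r⊆p─q F G S)))
    (Nonempty⇒0<∣p∣ (⊈⇒Nonempty─ F∩S⊈G∩S))
  F∩S─G∩S⊆F∩S─H∩S : (F ∩ S) ─ (G ∩ S) ⊆ (F ∩ S) ─ (H ∩ S)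
  F∩S─G∩S⊆F∩S─H∩S x∈ =
    x∈p∧x∉q⇒x∈p─q (proj₁ (x∈p─q⁻ x∈))
                  (λ x∈H∩S → proj₂ (x∈p─q⁻ (F─G⊆F─H (p∩r─q∩r⊆p─q F G S x∈)))
                                   (proj₁ (x∈p∩q⁻ H S x∈H∩S)))
  G∩S─F∩S⊆H∩S : (G ∩ S) ─ (F ∩ S) ⊆ H ∩ S
  G∩S─F∩S⊆H∩S x∈ =
    x∈p∩q⁺ (G─F⊆H (p∩r─q∩r⊆p─q G F S x∈) , proj₂ (x∈p∩q⁻ G S (proj₁ (x∈p─q⁻ x∈))))

step-cong : ∀ {n} {F F′ G G′ H H′ : Subset n} → F ≡ F′ → G ≡ G′ → H ≡ H′ →
            StrongShellingStep F′ G′ H′ → StrongShellingStep F G H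
step-cong refl refl refl step = step

-- Face Δ is not decidable, so a face extends to a facet only under double negation.
face⊆facet : ∀ {n} (Δ : Complex n) {G} → Face Δ G → ¬ ¬ (∃ λ σ → IsFacet Δ σ × G ⊆ σ)
face⊆facet {n} Δ {G} = extend (suc (n ∸ ∣ G ∣)) (ℕ.n<1+n _)
  where
  extend : ∀ k {G} → n ∸ ∣ G ∣ <ℕ k → Face Δ G → ¬ ¬ (∃ λ σ → IsFacet Δ σ × G ⊆ σ)
  extend (suc k) {G} bound G∈Δ no-facet = no-facet (G , (G∈Δ , maximal) , λ x∈G → x∈G)
    where
    maximal : ∀ H → Face Δ H → G ⊆ H → H ≡ G
    maximal H H∈Δ G⊆H with H ≟ₛ G
    ... | yes H≡G = H≡G
    ... | no  H≢G = contradiction (λ (σ , σ-facet , H⊆σ) → no-facet (σ , σ-facet , H⊆σ ∘ G⊆H))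
                                  (extend k H-bound H∈Δ)
      where
      H─G-nonempty : Nonempty (H ─ G)
      H─G-nonempty = ⊈⇒Nonempty─ (λ H⊆G → H≢G (⊆-antisym H⊆G G⊆H))
      ∣G∣<∣H∣ : ∣ G ∣ <ℕ ∣ H ∣
      ∣G∣<∣H∣ = p⊂q⇒∣p∣<∣q∣ (G⊆H , proj₁ H─G-nonempty , x∈p─q⁻ (proj₂ H─G-nonempty))
      H-bound : n ∸ ∣ H ∣ <ℕ k
      H-bound = ℕ.<-≤-trans (ℕ.∸-monoʳ-< ∣G∣<∣H∣ (∣p∣≤n H)) (ℕ.≤-pred bound)

module _ {n} (L : List (Subset n)) (S : Subset n) where

  isFirstRestriction? : ∀ F p → Dec (IsFirstRestriction L S F p)
  isFirstRestriction? F p =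
    (lookup L p ∩ S ≟ₛ F) ×-dec all? (λ q → q <? p →-dec ¬? (lookup L q ∩ S ≟ₛ F))

  firstRestriction-unique : ∀ {F p q} →
                            IsFirstRestriction L S F p → IsFirstRestriction L S F q → p ≡ q
  firstRestriction-unique {p = p} {q} (p↦F , before-p) (q↦F , before-q) with <-cmp p q
  ... | tri< p<q _ _ = contradiction p↦F (before-q p p<q)
  ... | tri≈ _ p≡q _ = p≡q
  ... | tri> _ _ q<p = contradiction q↦F (before-p q q<p)

  firstRestriction-exists : ∀ p → ∃ λ p′ → p′ ≤ p × IsFirstRestriction L S (lookup L p ∩ S) p′
  firstRestriction-exists p = least-witness (λ q → lookup L q ∩ S ≟ₛ lookup L p ∩ S) refl

module InducedOrder {n} {Δ : Complex n} {S : Subset n}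
  (restriction-facet : ∀ σ → IsFacet Δ σ → IsFacet (induced Δ S) (σ ∩ S))
  {L : List (Subset n)} (shelling : IsStrongShellingOrder Δ L) where

  restrict : Fin (length L) → Subset n
  restrict p = lookup L p ∩ S

  First : Fin (length L) → Set
  First p = IsFirstRestriction L S (restrict p) p

  first? : ∀ p → Dec (First p)
  first? p = isFirstRestriction? L S (restrict p) p

  IsFirstRestriction⇒First : ∀ {F p} → IsFirstRestriction L S F p → First p
  IsFirstRestriction⇒First {p = p} p-first@(p↦F , _) =
    subst (λ F → IsFirstRestriction L S F p) (sym p↦F) p-first

  firsts : List (Fin (length L))
  firsts = filter first? (allFin _)

  M : List (Subset n)
  M = map restrict firsts

  tilde : Fin (length M) → Fin (length L)
  tilde i = lookup firsts (cast (length-map restrict firsts) i)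

  lookup-M : ∀ i → lookup M i ≡ restrict (tilde i)
  lookup-M = lookup-map restrict firsts

  tilde-first : ∀ i → IsFirstRestriction L S (lookup M i) (tilde i)
  tilde-first i rewrite lookup-M i = All.lookup (all-filter first? (allFin _)) (∈-lookup _)

  tilde-mono : ∀ {i j} → i < j → tilde i < tilde j
  tilde-mono = AllPairs-lookup firsts-increasing ∘ cast-< _
    where
    firsts-increasing : AllPairs _<_ firsts
    firsts-increasing = filter⁺ first? (tabulate⁺-< {f = λ p → p} (λ p<q → p<q))

  tilde-reflect : ∀ {i j} → tilde i < tilde j → i < j
  tilde-reflect = <-reflect tilde-mono

  tilde-onto : ∀ {p} → First p → ∃ λ i → tilde i ≡ p
  tilde-onto p-first = cast (sym (length-map restrict firsts)) (index p∈firsts) ,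
    trans (cong (lookup firsts) (cast-involutive (length-map restrict firsts) _ (index p∈firsts)))
          (sym (lookup-index p∈firsts))
    where
    p∈firsts : _ ∈ firsts
    p∈firsts = ∈-filter⁺ first? (∈-allFin _) p-first

  restrict∈M : ∀ p → restrict p ∈ M
  restrict∈M p with p′ , _ , p′-first ← firstRestriction-exists L S p =
    subst (_∈ M) (proj₁ p′-first)
          (∈-map⁺ restrict (∈-filter⁺ first? (∈-allFin p′) (IsFirstRestriction⇒First p′-first)))

  L-facet : ∀ p → IsFacet Δ (lookup L p)
  L-facet p = proj₁ (proj₂ (proj₁ shelling)) _ (∈-lookup p)

  M⊆facets : ∀ F → F ∈ M → IsFacet (induced Δ S) F
  M⊆facets F F∈M with p , _ , refl ← ∈-map⁻ restrict F∈M = restriction-facet _ (L-facet p)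

  facets⊆M : ∀ G → IsFacet (induced Δ S) G → G ∈ M
  facets⊆M G ((G∈Δ , G⊆S) , G-maximal) =
    decidable-stable (any? (G ≟ₛ_) M) λ G∉M →
      face⊆facet Δ G∈Δ λ (σ , σ-facet , G⊆σ) →
        let σ∈L = proj₂ (proj₂ (proj₁ shelling)) σ σ-facet
            σ∩S≡G = G-maximal (σ ∩ S) (proj₁ (restriction-facet σ σ-facet))
                              (λ x∈G → x∈p∩q⁺ (G⊆σ x∈G , G⊆S x∈G))
        in G∉M (subst (_∈ M) (trans (cong (_∩ S) (sym (lookup-index σ∈L))) σ∩S≡G)
                          (restrict∈M (index σ∈L)))

  M-unique : Unique M
  M-unique = lookup⇒AllPairs λ {i} {j} i<j Mi≡Mj →
    proj₂ (tilde-first j) (tilde i) (tilde-mono i<j) (trans (sym (lookup-M i)) Mi≡Mj)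

  M-facetOrder : IsFacetOrder (induced Δ S) M
  M-facetOrder = M-unique , M⊆facets , facets⊆M

  M-induced : IsInducedOrder Δ S L M
  M-induced = M-facetOrder , orders-agree
    where
    orders-agree : ∀ i j p q → IsFirstRestriction L S (lookup M i) p →
                   IsFirstRestriction L S (lookup M j) q → (i < j → p < q) × (p < q → i < j)
    orders-agree i j p q p-first q-first
      rewrite firstRestriction-unique L S p-first (tilde-first i)
            | firstRestriction-unique L S q-first (tilde-first j) = tilde-mono , tilde-reflect

  M-shelling : IsStrongShellingOrder (induced Δ S) M
  M-shelling = M-facetOrder , exchange
    where
    exchange : ∀ i j → i < j → Σ (Fin (length M)) λ k →
               k < j × StrongShellingStep (lookup M j) (lookup M k) (lookup M i)
    exchange i j i<j
      with r , r<j̃ , step ← proj₂ shelling (tilde i) (tilde j) (tilde-mono i<j)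
      with r′ , r′≤r , r′-first ← firstRestriction-exists L S r
      with k , refl ← tilde-onto (IsFirstRestriction⇒First r′-first)
      = k , tilde-reflect (ℕ.≤-<-trans r′≤r r<j̃) ,
        step-cong (lookup-M j) (trans (lookup-M k) (proj₁ r′-first)) (lookup-M i)
                  (StrongShellingStep-∩ S step j̃∩S⊈r∩S)
      where
      j̃∩S⊈r∩S : ¬ restrict (tilde j) ⊆ restrict r
      j̃∩S⊈r∩S ⊆r =
        proj₂ (tilde-first j) r r<j̃
          (trans (proj₂ (restriction-facet _ (L-facet (tilde j))) (restrict r)
                        (proj₁ (restriction-facet _ (L-facet r))) ⊆r)
                 (sym (lookup-M j)))

  induced-shelling : Σ (List (Subset n)) λ M →
                       IsInducedOrder Δ S L M × IsStrongShellingOrder (induced Δ S) M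
  induced-shelling = M , M-induced , M-shelling

proposition2p15 : ∀ {n} (Δ : Complex n) (S : Subset n) →
    StronglyShellable Δ →
    (∀ σ → IsFacet Δ σ → IsFacet (induced Δ S) (σ ∩ S)) →
    StronglyShellable (induced Δ S) ×
    (∀ (L : List (Subset n)) → IsStrongShellingOrder Δ L →
       Σ (List (Subset n)) λ M →
         IsInducedOrder Δ S L M × IsStrongShellingOrder (induced Δ S) M)
proposition2p15 Δ S (L , shelling) restriction-facet =
  (proj₁ (induced-shelling shelling) , proj₂ (proj₂ (induced-shelling shelling))) ,
  λ _ → induced-shelling
  where open InducedOrder {Δ = Δ} {S} restriction-facet using (induced-shelling)
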